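{- Let $\sigma$ be an address and $\mathbb Nat=\{\mathbf n_\sigma\mid n\in\mathbb N\}$. Define designs $\mathfrak F_{\sigma.\overline i}$ ($i\in\mathbb N$) on base $\sigma.\overline i\vdash$ coinductively by $\mathfrak F_{\sigma.\overline i}=$ the prefix closure of $\{(-,\sigma.\overline i,\emptyset)\maltese\}\cup\{(-,\sigma.\overline i,\{0\})(+,\sigma.\overline i.0,\{1\})\mathfrak c\mid\mathfrak c\in\mathfrak F_{\sigma.\overline{i+1}}\}$. Then $|\mathbb Nat^\perp|=\{\mathfrak F_{\sigma.\overline 0}\}^{\maltese}$.
   Context: Ludics (Girard). Addresses: finite sequences of naturals. Actions: $(+,\xi,I)$, $(-,\xi,I)$ ($I$ finite set of naturals) and positive daimon $\maltese$. Chronicles: nonempty finite alternating sequences of actions on a base, each proper action initial or justified by an earlier action (non-initial negative ones by the immediately preceding action; an action on $\xi.i$ is justified by one of opposite polarity on $\xi$ with $i$ in its ramification), distinct addresses, $\maltese$ only last. A design: prefix-closed set of pairwise coherent chronicles on a base, maximal chronicles ending positively. Interaction of a closed cut-net: start from the positive design; $\maltese$ gives $\{\maltese\}$; $(+,\sigma,I)$ requires a chronicle starting $(-,\sigma,I)$ in the design cut on $\sigma$ (else failure) and continues above. $\perp$: result $\{\maltese\}$; $E^\perp$ designs orthogonal to all of $E$. Incarnation $|\mathfrak D|_{\mathbf G}=\bigcap\{\mathfrak D'\subseteq\mathfrak D\mid\mathfrak D'\in\mathbf G\}$, material iff equal, $|\mathbf G|$ material designs. $\maltese$-shorten of chronicle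 $\mathfrak c$: $\mathfrak c$ or $\mathfrak c_1\maltese$ with $\mathfrak c=\mathfrak c_1\mathfrak c_2$, $\mathfrak c_1$ ending negatively; $E^{\maltese}$ designs obtained from designs of $E$ by $\maltese$-shortening chronicles. Naturals: $\overline0=\epsilon$, $\overline{k+1}=\overline k.0.1$; $\mathbf 0_\tau=\{(+,\tau,\emptyset)\}$, $(\mathbf{k+1})_\tau$ the prefix closure of $\{(+,\tau,\{0\})(-,\tau.0,\{1\})\mathfrak c\mid\mathfrak c\in\mathbf k_{\tau.0.1}\}$, a design on $\vdash\tau$. -}

module Defs where

open import Level using (Level)
open import Data.Nat using (ℕ; zero; suc; _<_)
open import Data.List using (List; []; _∷_; _++_; _∷ʳ_)
open import Data.List.Membership.Propositional using (_∈_)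
open import Data.List.Relation.Unary.Linked using (Linked)
open import Data.Product using (Σ; ∃; ∃-syntax; _×_; _,_)
open import Data.Sum using (_⊎_)
open import Data.Empty using (⊥)
open import Data.Unit using (⊤)
open import Relation.Nullary using (¬_)
open import Relation.Binary.PropositionalEquality using (_≡_; _≢_)

Addr : Set
Addr = List ℕ            -- ξ.i is  ξ ++ (i ∷ [])

data Pol : Set where
  pos neg : Pol

opp : Pol → Pol
opp pos = neg
opp neg = pos

-- A finite set of naturals (ramification) is a strictly increasing list;
-- this is imposed in IsChronicle, so list equality = set equality.
data Action : Set where
  daimon : Action
  act    : Pol → Addr → List ℕ → Action

polOf : Action → Pol
polOf daimon      = pos
polOf (act p _ _) = p

Chron : Set
Chron = List Action

-- atomic bases:  ⊢ ξ  (positive)  and  ξ ⊢  (negative)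
data Base : Set where
  pbase : Addr → Base
  nbase : Addr → Base

Alternating : Chron → Set
Alternating (a ∷ b ∷ r) = polOf b ≡ opp (polOf a) × Alternating (b ∷ r)
Alternating _           = ⊤

Initial : Base → Pol → Addr → Set
Initial (pbase β) p ξ = p ≡ pos × ξ ≡ β
Initial (nbase β) p ξ = p ≡ neg × ξ ≡ β

Justified : Chron → Pol → Addr → Set
Justified u pos ξ = ∃[ ζ ] ∃[ i ] ∃[ J ] (ξ ≡ ζ ++ (i ∷ []) × i ∈ J × act neg ζ J ∈ u)
Justified u neg ξ = ∃[ ζ ] ∃[ i ] ∃[ J ] ∃[ u' ]
                      (ξ ≡ ζ ++ (i ∷ []) × i ∈ J × u ≡ u' ∷ʳ act pos ζ J)

record IsChronicle (b : Base) (c : Chron) : Set where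
  field
    nonEmpty    : c ≢ []
    alternating : Alternating c
    daimonLast  : ∀ u v → c ≡ u ++ daimon ∷ v → v ≡ []
    ramSorted   : ∀ p ξ I → act p ξ I ∈ c → Linked _<_ I
    distinct    : ∀ u v w p q ξ I J → c ≢ u ++ act p ξ I ∷ v ++ act q ξ J ∷ w
    justified   : ∀ u v p ξ I → c ≡ u ++ act p ξ I ∷ v → Initial b p ξ ⊎ Justified u p ξ

Prefix : Chron → Chron → Set
Prefix c c' = ∃[ u ] (c ++ u ≡ c')

EndsNeg : Chron → Set
EndsNeg c = ∃[ u ] ∃[ ξ ] ∃[ I ] (c ≡ u ∷ʳ act neg ξ I)

Coherent : Chron → Chron → Set
Coherent c c' =
  Prefix c c' ⊎ Prefix c' c ⊎
  (∃[ w ] ∃[ a ] ∃[ a' ] ∃[ u ] ∃[ u' ]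
     (c ≡ w ++ a ∷ u × c' ≡ w ++ a' ∷ u' × a ≢ a' ×
      polOf a ≡ neg × polOf a' ≡ neg × a ≢ daimon × a' ≢ daimon ×
      (∀ ξ I J → act pos ξ I ∈ u → act pos ξ J ∈ u' → ⊥)))

Des : Set₁
Des = Chron → Set

record IsDesign (b : Base) (D : Des) : Set where
  field
    chron    : ∀ c → D c → IsChronicle b c
    prefixCl : ∀ c a → c ≢ [] → D (c ∷ʳ a) → D c
    coherent : ∀ c c' → D c → D c' → Coherent c c'
    maxPos   : ∀ c → D c → EndsNeg c → ∃[ a ] D (c ∷ʳ a)

-- Interaction of the closed cut-net  P (on ⊢σ) / N (on σ⊢).
-- Conv X Y LX LY κ : X has just played κ (LX, LY = chronicles of X, Y
-- reached so far, each ending with a positive action); the interaction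
-- terminates on ✠.

data Conv : Des → Des → List Chron → List Chron → Action → Set₁ where
  done : ∀ {X Y LX LY} → Conv X Y LX LY daimon
  step : ∀ {X Y LX LY ξ I d κ} →
         d ∈ ([] ∷ LY) →
         Y (d ++ act neg ξ I ∷ κ ∷ []) →
         Conv Y X ((d ++ act neg ξ I ∷ κ ∷ []) ∷ LY) LX κ →
         Conv X Y LX LY (act pos ξ I)

-- P positive, N negative: the normal form is {✠}
Orth : Des → Des → Set₁
Orth P N = ∃[ κ ] (P (κ ∷ []) × Conv P N ((κ ∷ []) ∷ []) [] κ)

bar : ℕ → Addr
bar zero    = []
bar (suc k) = bar k ++ (0 ∷ 1 ∷ [])

NatD : ℕ → Addr → Des
NatD zero    τ c = c ≡ act pos τ [] ∷ []
NatD (suc k) τ c =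
  c ≡ act pos τ (0 ∷ []) ∷ [] ⊎
  c ≡ act pos τ (0 ∷ []) ∷ act neg (τ ++ (0 ∷ [])) (1 ∷ []) ∷ [] ⊎
  ∃[ c' ] (NatD k (τ ++ (0 ∷ 1 ∷ [])) c' ×
           c ≡ act pos τ (0 ∷ []) ∷ act neg (τ ++ (0 ∷ [])) (1 ∷ []) ∷ c')

InNatPerp : Addr → Des → Set₁
InNatPerp σ E = IsDesign (nbase σ) E × (∀ n → Orth (NatD n σ) E)

-- material designs of Nat^⊥ :  D ∈ Nat^⊥ and |D| = ⋂{D' ⊆ D | D' ∈ Nat^⊥} = D
MaterialNatPerp : Addr → Des → Set₁
MaterialNatPerp σ D =
  InNatPerp σ D ×
  (∀ D' → InNatPerp σ D' → (∀ c → D' c → D c) → ∀ c → D c → D' c)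

-- The designs F_{σ.ī}  (prefix closure of the defining set; since
-- chronicles are finite, the coinductive definition determines exactly
-- this inductively generated set of chronicles)

data FD (σ : Addr) : ℕ → Des where
  fEmpty  : ∀ {i} → FD σ i (act neg (σ ++ bar i) [] ∷ [])
  fEmptyD : ∀ {i} → FD σ i (act neg (σ ++ bar i) [] ∷ daimon ∷ [])
  fZero   : ∀ {i} → FD σ i (act neg (σ ++ bar i) (0 ∷ []) ∷ [])
  fZeroP  : ∀ {i} → FD σ i (act neg (σ ++ bar i) (0 ∷ []) ∷
                             act pos (σ ++ bar i ++ (0 ∷ [])) (1 ∷ []) ∷ [])
  fNext   : ∀ {i c} → FD σ (suc i) c →
            FD σ i (act neg (σ ++ bar i) (0 ∷ []) ∷
                    act pos (σ ++ bar i ++ (0 ∷ [])) (1 ∷ []) ∷ c)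

IsShortening : Chron → Chron → Set
IsShortening s c = s ≡ c ⊎ ∃[ c₁ ] ∃[ c₂ ] (c ≡ c₁ ++ c₂ × EndsNeg c₁ × s ≡ c₁ ∷ʳ daimon)

-- D ∈ {E}^✠ : D is obtained from E by replacing each chronicle by a
-- ✠-shortening of it (D is separately required to be a design).
ShortOf : Des → Des → Set
ShortOf E D =
  Σ ((c : Chron) → E c → Chron) λ s →
    (∀ c (p : E c) → IsShortening (s c p) c) ×
    (∀ c → (D c → ∃[ c' ] Σ (E c') λ p → s c' p ≡ c) ×
           ((∃[ c' ] Σ (E c') λ p → s c' p ≡ c) → D c))

-- Every chronicle of F_{σ.0̄} is a chain (−,σ.0̄,{0})(+,σ.0̄.0,{1})(−,σ.1̄,{0})(+,σ.1̄.0,{1})… of depth k followed by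
-- (−,σ.k̄,∅), (−,σ.k̄,∅)✠, (−,σ.k̄,{0}) or (−,σ.k̄,{0})(+,σ.k̄.0,{1}); ✠-shortening only adds the endings
-- (−,σ.ḡ,{0})✠.  Following the interaction, a design on σ⊢ is orthogonal to n_σ iff it contains chain n (−,σ.n̄,∅)✠
-- or chain g (−,σ.ḡ,{0})✠ for some g < n, and by coherence nothing of depth > g survives next to the latter.
-- A design of {F}^✠ answers every n_σ in this way and each of its chronicles lies below such an answer, so every
-- D' ⊆ D in Nat^⊥ contains it: D is material.  Conversely a material D lies inside the ✠-shortenings of F (their
-- intersection with D is still in Nat^⊥), and for a chronicle of F of depth k the way D answers n = k+1 tells
-- which shortening of it belongs to D.

module Submission where

open import Defs
open import Data.Nat using (ℕ; zero; suc; _+_; _≤_; _<_; z≤n; s≤s)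
open import Data.Nat.Properties
  using (≤-refl; <⇒≤; <-≤-trans; <-cmp; m≤n⇒m≤1+n; m<1+n⇒m<n∨m≡n; m≤n⇒m<n∨m≡n; +-suc; +-identityʳ; m≤n+m)
open import Data.List using (List; []; _∷_; _++_; _∷ʳ_)
open import Data.List.Properties
  using ( ++-assoc; ++-identityʳ; ++-cancelˡ; ++-cancelʳ; ∷ʳ-injective; ∷ʳ-injectiveˡ; ∷ʳ-++
        ; ∷-injectiveˡ; ∷-injectiveʳ)
open import Data.List.Membership.Propositional using (_∈_)
open import Data.List.Membership.Propositional.Properties using (∈-++⁻)
open import Data.List.Relation.Unary.Any using (here; there)
open import Data.Product using (Σ; ∃-syntax; _×_; _,_; proj₁; proj₂)
open import Data.Sum using (_⊎_; inj₁; inj₂)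
open import Data.Empty using (⊥; ⊥-elim)
open import Data.Unit using (⊤; tt)
open import Relation.Nullary using (¬_)
open import Relation.Binary using (tri<; tri≈; tri>)
open import Relation.Binary.PropositionalEquality
open import Function.Base using (_∘_)
open import Function.Bundles using (_⇔_; mk⇔)

++-∷-≢-[] : ∀ {A : Set} (u : List A) {x v} → u ++ x ∷ v ≢ []
++-∷-≢-[] []      ()
++-∷-≢-[] (_ ∷ _) ()

EndsNeg-++-∷-∷ : ∀ w x y → EndsNeg (w ++ x ∷ y ∷ []) → polOf y ≡ neg
EndsNeg-++-∷-∷ w x y (u , _ , _ , e) with ∷ʳ-injective (w ∷ʳ x) u (trans (∷ʳ-++ w x (y ∷ [])) e)
... | _ , refl = refl

PrefixClosed : Des → Set
PrefixClosed E = ∀ c a → c ≢ [] → E (c ∷ʳ a) → E c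

prefixClosed-++ : ∀ {E} → PrefixClosed E → ∀ c r → c ≢ [] → E (c ++ r) → E c
prefixClosed-++ {E} pc c []      _  p = subst E (++-identityʳ c) p
prefixClosed-++ {E} pc c (a ∷ r) ne p =
  pc c a ne (prefixClosed-++ pc (c ∷ʳ a) r (++-∷-≢-[] c) (subst E (sym (∷ʳ-++ c a r)) p))

prefixClosed-∷ʳ : ∀ {E} → PrefixClosed E → ∀ w x r → E (w ++ x ∷ r) → E (w ∷ʳ x)
prefixClosed-∷ʳ {E} pc w x r p = prefixClosed-++ pc (w ∷ʳ x) r (++-∷-≢-[] w) (subst E (sym (∷ʳ-++ w x r)) p)

IsCoherent : Des → Set
IsCoherent E = ∀ c c' → E c → E c' → Coherent c c'

first-difference : ∀ (w w' : Chron) {a b a' b' u v u' v'} →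
                   w ++ a ∷ u ≡ w' ++ a' ∷ u' → w ++ b ∷ v ≡ w' ++ b' ∷ v' → a' ≢ b' →
                   (a ≡ a' × b ≡ b') ⊎ a ≡ b
first-difference []      []       refl refl _   = inj₁ (refl , refl)
first-difference []      (_ ∷ _)  refl refl _   = inj₂ refl
first-difference (_ ∷ _) []       refl refl a≢b = ⊥-elim (a≢b refl)
first-difference (_ ∷ w) (_ ∷ w') e    e'   a≢b =
  first-difference w w' (∷-injectiveʳ e) (∷-injectiveʳ e') a≢b

positive-branch-incoherent : ∀ (w : Chron) {a b u v} → a ≢ b → polOf a ≡ pos → polOf b ≡ pos →
                             ¬ Coherent (w ++ a ∷ u) (w ++ b ∷ v)
positive-branch-incoherent w {a} {u = u} a≢b _ _ (inj₁ (x , e)) =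
  a≢b (∷-injectiveˡ (++-cancelˡ w _ _ (trans (sym (++-assoc w (a ∷ u) x)) e)))
positive-branch-incoherent w {b = b} {v = v} a≢b _ _ (inj₂ (inj₁ (x , e))) =
  a≢b (sym (∷-injectiveˡ (++-cancelˡ w _ _ (trans (sym (++-assoc w (b ∷ v) x)) e))))
positive-branch-incoherent w a≢b pa _ (inj₂ (inj₂ (w' , _ , _ , _ , _ , e , e' , a'≢b' , na' , _)))
  with first-difference w w' e e' a'≢b'
... | inj₁ (refl , _) with trans (sym pa) na'
...   | ()
positive-branch-incoherent w a≢b _ _ (inj₂ (inj₂ _)) | inj₂ a≡b = a≢b a≡b

bar-injective : ∀ m n → bar m ≡ bar n → m ≡ n
bar-injective zero    zero    _ = refl
bar-injective zero    (suc n) e = ⊥-elim (++-∷-≢-[] (bar n) (sym e))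
bar-injective (suc m) zero    e = ⊥-elim (++-∷-≢-[] (bar m) e)
bar-injective (suc m) (suc n) e = cong suc (bar-injective m n (++-cancelʳ (0 ∷ 1 ∷ []) (bar m) (bar n) e))

-- The ramification of the k-th positive action of n_τ; junk ([]) for k > n.
natRam : ℕ → ℕ → List ℕ
natRam zero    _       = []
natRam (suc n) zero    = 0 ∷ []
natRam (suc n) (suc k) = natRam n k

natRam-< : ∀ {n k} → k < n → natRam n k ≡ 0 ∷ []
natRam-< {suc n} {zero}  _       = refl
natRam-< {suc n} {suc k} (s≤s p) = natRam-< p

natRam-self : ∀ n → natRam n n ≡ []
natRam-self zero    = refl
natRam-self (suc n) = natRam-self n

module _ (σ : Addr) where

  a⁻ : ℕ → List ℕ → Action
  a⁻ k I = act neg (σ ++ bar k) I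

  a⁺ : ℕ → Action
  a⁺ k = act pos (σ ++ bar k ++ 0 ∷ []) (1 ∷ [])

  -- For p = neg a step of F_{σ.0̄}, for p = pos a step of n_σ.
  pair : Pol → ℕ → Chron
  pair p i = act p (σ ++ bar i) (0 ∷ []) ∷ act (opp p) (σ ++ bar i ++ 0 ∷ []) (1 ∷ []) ∷ []

  links : Pol → ℕ → ℕ → Chron
  links p i zero    = []
  links p i (suc k) = pair p i ++ links p (suc i) k

  links-suc : ∀ p i k → links p i (suc k) ≡ links p i k ++ pair p (i + k)
  links-suc p i zero    = trans (++-identityʳ (pair p i)) (cong (pair p) (sym (+-identityʳ i)))
  links-suc p i (suc k) =
    cong (pair p i ++_) (trans (links-suc p (suc i) k)
                               (cong (λ j → links p (suc i) k ++ pair p j) (sym (+-suc i k))))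

  chain : ℕ → Chron
  chain = links neg 0

  chain-suc : ∀ k → chain (suc k) ≡ chain k ++ a⁻ k (0 ∷ []) ∷ a⁺ k ∷ []
  chain-suc = links-suc neg 0

  chain-suc-∷ʳ : ∀ k → chain (suc k) ≡ (chain k ∷ʳ a⁻ k (0 ∷ [])) ∷ʳ a⁺ k
  chain-suc-∷ʳ k = trans (chain-suc k) (sym (∷ʳ-++ (chain k) _ (a⁺ k ∷ [])))

  chain-suc-++ : ∀ k r → chain (suc k) ++ r ≡ chain k ++ a⁻ k (0 ∷ []) ∷ a⁺ k ∷ r
  chain-suc-++ k r = trans (cong (_++ r) (chain-suc k)) (++-assoc (chain k) (pair neg k) r)

  chain-extends : ∀ {j k} → j < k →
                  ∃[ rest ] ∀ r → chain k ++ r ≡ chain j ++ a⁻ j (0 ∷ []) ∷ a⁺ j ∷ rest ++ r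
  chain-extends {j} {suc k} j<1+k with m<1+n⇒m<n∨m≡n j<1+k
  ... | inj₂ refl = [] , chain-suc-++ j
  ... | inj₁ j<k with chain-extends j<k
  ...   | rest , e = rest ++ pair neg k , λ r → begin
    chain (suc k) ++ r                                      ≡⟨ chain-suc-++ k r ⟩
    chain k ++ pair neg k ++ r                              ≡⟨ e (pair neg k ++ r) ⟩
    chain j ++ a⁻ j (0 ∷ []) ∷ a⁺ j ∷ rest ++ pair neg k ++ r ≡⟨ cong (λ x → chain j ++ a⁻ j (0 ∷ []) ∷ a⁺ j ∷ x)
                                                                  (sym (++-assoc rest (pair neg k) r)) ⟩
    chain j ++ a⁻ j (0 ∷ []) ∷ a⁺ j ∷ (rest ++ pair neg k) ++ r ∎
    where open ≡-Reasoning

  chain-¬EndsNeg : ∀ k → ¬ EndsNeg (chain k)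
  chain-¬EndsNeg zero    (u , _ , _ , e) = ++-∷-≢-[] u (sym e)
  chain-¬EndsNeg (suc k) en with EndsNeg-++-∷-∷ (chain k) _ (a⁺ k) (subst EndsNeg (chain-suc k) en)
  ... | ()

  data Tail : Set where
    t∅ t∅✠ t0 t0⁺ t0✠ : Tail

  ram : Tail → List ℕ
  ram t∅  = []
  ram t∅✠ = []
  ram _   = 0 ∷ []

  after : ℕ → Tail → Chron
  after k t∅  = []
  after k t∅✠ = daimon ∷ []
  after k t0  = []
  after k t0⁺ = a⁺ k ∷ []
  after k t0✠ = daimon ∷ []

  ending : ℕ → Tail → Chron
  ending k t = a⁻ k (ram t) ∷ after k t

  daimonAfter : Tail → Tail
  daimonAfter t∅  = t∅✠
  daimonAfter t∅✠ = t∅✠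
  daimonAfter _   = t0✠

  ending-daimonAfter : ∀ k t → ending k (daimonAfter t) ≡ a⁻ k (ram t) ∷ daimon ∷ []
  ending-daimonAfter k t∅  = refl
  ending-daimonAfter k t∅✠ = refl
  ending-daimonAfter k t0  = refl
  ending-daimonAfter k t0⁺ = refl
  ending-daimonAfter k t0✠ = refl

  InF : Tail → Set
  InF t0✠ = ⊥
  InF _   = ⊤

  -- all ✠-shortenings of chronicles of F_{σ.0̄}
  F✠ : Des
  F✠ c = ∃[ k ] ∃[ t ] (c ≡ chain k ++ ending k t)

  FView : Chron → Set
  FView c = ∃[ k ] ∃[ t ] (InF t × c ≡ chain k ++ ending k t)

  FD-view : ∀ {i c} → FD σ i c → FView (chain i ++ c)
  FD-view {i} fEmpty  = i , t∅  , tt , refl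
  FD-view {i} fEmptyD = i , t∅✠ , tt , refl
  FD-view {i} fZero   = i , t0  , tt , refl
  FD-view {i} fZeroP  = i , t0⁺ , tt , refl
  FD-view {i} (fNext {c = c} p) with FD-view p
  ... | k , t , t∈F , e = k , t , t∈F , trans (sym (chain-suc-++ i c)) e

  FD-ending : ∀ k t → InF t → FD σ k (ending k t)
  FD-ending k t∅  _ = fEmpty
  FD-ending k t∅✠ _ = fEmptyD
  FD-ending k t0  _ = fZero
  FD-ending k t0⁺ _ = fZeroP

  FD-chain : ∀ k {c} → FD σ k c → FD σ 0 (chain k ++ c)
  FD-chain zero    p = p
  FD-chain (suc k) p = subst (FD σ 0) (sym (chain-suc-++ k _)) (FD-chain k (fNext p))

  F-chronicle : ∀ k t → InF t → FD σ 0 (chain k ++ ending k t)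
  F-chronicle k t t∈F = FD-chain k (FD-ending k t t∈F)

  tailOf : Chron → Tail
  tailOf (act _ _ []      ∷ [])                  = t∅
  tailOf (act _ _ []      ∷ _ ∷ [])              = t∅✠
  tailOf (act _ _ (_ ∷ _) ∷ [])                  = t0
  tailOf (act _ _ (_ ∷ _) ∷ act _ _ _ ∷ [])      = t0⁺
  tailOf _                                       = t0✠

  tailOf-ending : ∀ k t → tailOf (ending k t) ≡ t
  tailOf-ending k t∅  = refl
  tailOf-ending k t∅✠ = refl
  tailOf-ending k t0  = refl
  tailOf-ending k t0⁺ = refl
  tailOf-ending k t0✠ = refl

  ending-∷-∷-≢ : ∀ k t k' t' {x y} r → ending k t ≢ x ∷ y ∷ r ++ ending k' t'
  ending-∷-∷-≢ k t∅  _ _  _ ()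
  ending-∷-∷-≢ k t0  _ _  _ ()
  ending-∷-∷-≢ k t∅✠ k' t' r e = ++-∷-≢-[] r (sym (∷-injectiveʳ (∷-injectiveʳ e)))
  ending-∷-∷-≢ k t0✠ k' t' r e = ++-∷-≢-[] r (sym (∷-injectiveʳ (∷-injectiveʳ e)))
  ending-∷-∷-≢ k t0⁺ k' t' r e = ++-∷-≢-[] r (sym (∷-injectiveʳ (∷-injectiveʳ e)))

  chain-ending-≢-deeper : ∀ {j k t t'} → j < k → chain j ++ ending j t ≢ chain k ++ ending k t'
  chain-ending-≢-deeper {j} {k} {t} {t'} j<k e with chain-extends j<k
  ... | rest , e' = ending-∷-∷-≢ j t k t' rest (++-cancelˡ (chain j) _ _ (trans e (e' (ending k t'))))

  chain-ending-injective : ∀ {k k' t t'} → chain k ++ ending k t ≡ chain k' ++ ending k' t' → k ≡ k' × t ≡ t'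
  chain-ending-injective {k} {k'} {t} {t'} e with <-cmp k k'
  ... | tri< k<k' _ _ = ⊥-elim (chain-ending-≢-deeper k<k' e)
  ... | tri> _ _ k'<k = ⊥-elim (chain-ending-≢-deeper k'<k (sym e))
  ... | tri≈ _ refl _ =
    refl , trans (sym (tailOf-ending k t)) (trans (cong tailOf (++-cancelˡ (chain k) _ _ e)) (tailOf-ending k t'))

  EndsNeg-prefix-chain : ∀ k r c₁ c₂ → chain k ++ r ≡ c₁ ++ c₂ → EndsNeg c₁ →
                         (∃[ j ] (j < k × c₁ ≡ chain j ∷ʳ a⁻ j (0 ∷ []))) ⊎
                         (∃[ r₁ ] ∃[ r₂ ] (r ≡ r₁ ++ r₂ × c₁ ≡ chain k ++ r₁))
  EndsNeg-prefix-chain zero    r c₁ c₂ e _ = inj₂ (c₁ , c₂ , e , refl)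
  EndsNeg-prefix-chain (suc k) r c₁ c₂ e en
    with EndsNeg-prefix-chain k (a⁻ k (0 ∷ []) ∷ a⁺ k ∷ r) c₁ c₂ (trans (sym (chain-suc-++ k r)) e) en
  ... | inj₁ (j , j<k , e₁) = inj₁ (j , m≤n⇒m≤1+n j<k , e₁)
  ... | inj₂ ([] , _ , _ , e₁) =
    ⊥-elim (chain-¬EndsNeg k (subst EndsNeg (trans e₁ (++-identityʳ (chain k))) en))
  ... | inj₂ (_ ∷ [] , _ , refl , e₁) = inj₁ (k , ≤-refl , e₁)
  ... | inj₂ (_ ∷ _ ∷ r₁ , r₂ , refl , e₁) = inj₂ (r₁ , r₂ , refl , trans e₁ (sym (chain-suc-++ k r₁)))

  EndsNeg-prefix-ending : ∀ k t r₁ {r₂} → ending k t ≡ r₁ ++ r₂ → EndsNeg (chain k ++ r₁) →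
                          r₁ ≡ a⁻ k (ram t) ∷ []
  EndsNeg-prefix-ending k t [] _ en =
    ⊥-elim (chain-¬EndsNeg k (subst EndsNeg (++-identityʳ (chain k)) en))
  EndsNeg-prefix-ending k t (x ∷ []) e _ = cong (_∷ []) (sym (∷-injectiveˡ e))
  EndsNeg-prefix-ending k t∅  (x ∷ y ∷ r₁) () _
  EndsNeg-prefix-ending k t0  (x ∷ y ∷ r₁) () _
  EndsNeg-prefix-ending k t∅✠ (x ∷ y ∷ []) refl en with EndsNeg-++-∷-∷ (chain k) x y en
  ... | ()
  EndsNeg-prefix-ending k t0⁺ (x ∷ y ∷ []) refl en with EndsNeg-++-∷-∷ (chain k) x y en
  ... | ()
  EndsNeg-prefix-ending k t0✠ (x ∷ y ∷ []) refl en with EndsNeg-++-∷-∷ (chain k) x y en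
  ... | ()
  EndsNeg-prefix-ending k t∅✠ (x ∷ y ∷ _ ∷ _) () _
  EndsNeg-prefix-ending k t0⁺ (x ∷ y ∷ _ ∷ _) () _
  EndsNeg-prefix-ending k t0✠ (x ∷ y ∷ _ ∷ _) () _

  shortening-cases : ∀ {d} k t → IsShortening d (chain k ++ ending k t) →
                     d ≡ chain k ++ ending k t ⊎
                     (∃[ j ] (j < k × d ≡ chain j ++ ending j t0✠)) ⊎
                     d ≡ chain k ++ ending k (daimonAfter t)
  shortening-cases k t (inj₁ e) = inj₁ e
  shortening-cases k t (inj₂ (c₁ , c₂ , e , en , refl)) with EndsNeg-prefix-chain k (ending k t) c₁ c₂ e en
  ... | inj₁ (j , j<k , refl) = inj₂ (inj₁ (j , j<k , ∷ʳ-++ (chain j) _ (daimon ∷ [])))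
  ... | inj₂ (r₁ , r₂ , e₁ , refl) with EndsNeg-prefix-ending k t r₁ e₁ en
  ...   | refl = inj₂ (inj₂ (trans (∷ʳ-++ (chain k) _ (daimon ∷ []))
                                   (cong (chain k ++_) (sym (ending-daimonAfter k t)))))

  shortening-F✠ : ∀ {d} k t → IsShortening d (chain k ++ ending k t) → F✠ d
  shortening-F✠ k t sh with shortening-cases k t sh
  ... | inj₁ e                  = k , t , e
  ... | inj₂ (inj₁ (j , _ , e)) = j , t0✠ , e
  ... | inj₂ (inj₂ e)           = k , daimonAfter t , e

  chain-F✠ : ∀ k {c} → c ≡ chain k → c ≢ [] → F✠ c
  chain-F✠ zero    e c≢[] = ⊥-elim (c≢[] e)
  chain-F✠ (suc k) e _    = k , t0⁺ , trans e (chain-suc k)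

  F✠-prefixClosed : PrefixClosed F✠
  F✠-prefixClosed c a c≢[] (k , t , e) with t
  ... | t∅  = chain-F✠ k (∷ʳ-injectiveˡ c (chain k) e) c≢[]
  ... | t0  = chain-F✠ k (∷ʳ-injectiveˡ c (chain k) e) c≢[]
  ... | t∅✠ = k , t∅ , ∷ʳ-injectiveˡ c (chain k ∷ʳ _) (trans e (sym (∷ʳ-++ (chain k) _ (daimon ∷ []))))
  ... | t0✠ = k , t0 , ∷ʳ-injectiveˡ c (chain k ∷ʳ _) (trans e (sym (∷ʳ-++ (chain k) _ (daimon ∷ []))))
  ... | t0⁺ = k , t0 , ∷ʳ-injectiveˡ c (chain k ∷ʳ _) (trans e (sym (∷ʳ-++ (chain k) _ (a⁺ k ∷ []))))

  daimonAt : ℕ → List ℕ → Chron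
  daimonAt g I = chain g ++ a⁻ g I ∷ daimon ∷ []

  DaimonBefore : Des → ℕ → Set
  DaimonBefore E zero    = ⊥
  DaimonBefore E (suc n) = DaimonBefore E n ⊎ E (chain n ++ ending n t0✠)

  -- How a design orthogonal to n_σ ends the interaction: by ✠ after (−,σ.n̄,∅) at depth n,
  -- or earlier, after some (−,σ.ḡ,{0}).
  Answers : Des → ℕ → Set
  Answers E n = E (chain n ++ ending n t∅✠) ⊎ DaimonBefore E n

  daimonBefore-intro : ∀ {E g n} → g < n → E (chain g ++ ending g t0✠) → DaimonBefore E n
  daimonBefore-intro {n = suc n} g<1+n p with m<1+n⇒m<n∨m≡n g<1+n
  ... | inj₁ g<n  = inj₁ (daimonBefore-intro g<n p)
  ... | inj₂ refl = inj₂ p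

  daimonBefore-witness : ∀ {E} n → DaimonBefore E n → ∃[ g ] (g < n × E (chain g ++ ending g t0✠))
  daimonBefore-witness (suc n) (inj₂ p) = n , ≤-refl , p
  daimonBefore-witness (suc n) (inj₁ d) with daimonBefore-witness n d
  ... | g , g<n , p = g , m≤n⇒m≤1+n g<n , p

  daimonBefore-map : ∀ {E E'} → (∀ g → E (chain g ++ ending g t0✠) → E' (chain g ++ ending g t0✠)) →
                     ∀ n → DaimonBefore E n → DaimonBefore E' n
  daimonBefore-map f (suc n) (inj₁ d) = inj₁ (daimonBefore-map f n d)
  daimonBefore-map f (suc n) (inj₂ p) = inj₂ (f n p)

  daimonBefore-excludes : ∀ {E} → IsCoherent E → ∀ n {r} → DaimonBefore E n → ¬ E (chain n ++ r)
  daimonBefore-excludes {E} coh (suc n) {r} (inj₁ d) p =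
    daimonBefore-excludes coh n d (subst E (chain-suc-++ n r) p)
  daimonBefore-excludes {E} coh (suc n) {r} (inj₂ q) p =
    positive-branch-incoherent (chain n ∷ʳ a⁻ n (0 ∷ [])) (λ ()) refl refl
      (coh _ _ (subst E (sym (∷ʳ-++ (chain n) _ (daimon ∷ []))) q)
               (subst E (trans (chain-suc-++ n r) (sym (∷ʳ-++ (chain n) _ (a⁺ n ∷ r)))) p))

  reply⇒answers : ∀ {E n g} → g ≤ n → E (daimonAt g (natRam n g)) → Answers E n
  reply⇒answers {E} {n} {g} g≤n p with m≤n⇒m<n∨m≡n g≤n
  ... | inj₁ g<n  = inj₂ (daimonBefore-intro g<n (subst (E ∘ daimonAt g) (natRam-< g<n) p))
  ... | inj₂ refl = inj₁ (subst (E ∘ daimonAt g) (natRam-self g) p)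

  answers⇒reply : ∀ {E} n → Answers E n → ∃[ g ] (g ≤ n × E (daimonAt g (natRam n g)))
  answers⇒reply {E} n (inj₁ p) = n , ≤-refl , subst (E ∘ daimonAt n) (sym (natRam-self n)) p
  answers⇒reply {E} n (inj₂ d) with daimonBefore-witness n d
  ... | g , g<n , p = g , <⇒≤ g<n , subst (E ∘ daimonAt g) (sym (natRam-< g<n)) p

  nat-walk : ∀ n i k j → k ≤ n → j ≡ i + k →
             NatD n (σ ++ bar i) (links pos i k ++ act pos (σ ++ bar j) (natRam n k) ∷ [])
  nat-walk zero    i zero    _ _ refl = cong (λ m → act pos (σ ++ bar m) [] ∷ []) (+-identityʳ i)
  nat-walk (suc n) i zero    _ _ refl = inj₁ (cong (λ m → act pos (σ ++ bar m) (0 ∷ []) ∷ []) (+-identityʳ i))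
  nat-walk (suc n) i (suc k) j (s≤s k≤n) j≡ =
    inj₂ (inj₂ (rest , subst (λ τ → NatD n τ rest) (sym (++-assoc σ (bar i) (0 ∷ 1 ∷ [])))
                             (nat-walk n (suc i) k j k≤n (trans j≡ (+-suc i k))) ,
                cong (λ ξ → act pos (σ ++ bar i) (0 ∷ []) ∷ act neg ξ (1 ∷ []) ∷ rest)
                     (sym (++-assoc σ (bar i) (0 ∷ [])))))
    where
    rest : Chron
    rest = links pos (suc i) k ++ act pos (σ ++ bar j) (natRam n k) ∷ []

  nat-chronicle : ∀ n k → k ≤ n → NatD n σ (links pos 0 k ++ act pos (σ ++ bar k) (natRam n k) ∷ [])
  nat-chronicle n k k≤n =
    subst (λ τ → NatD n τ (links pos 0 k ++ act pos (σ ++ bar k) (natRam n k) ∷ [])) (++-identityʳ σ)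
          (nat-walk n 0 k k k≤n refl)

  nat-first : ∀ n τ κ → NatD n τ (κ ∷ []) → κ ≡ act pos τ (natRam n 0)
  nat-first zero    τ κ refl                     = refl
  nat-first (suc n) τ κ (inj₁ refl)              = refl
  nat-first (suc n) τ κ (inj₂ (inj₁ ()))
  nat-first (suc n) τ κ (inj₂ (inj₂ (_ , _ , ())))

  nat-reply : ∀ n i {τ} → τ ≡ σ ++ bar i → ∀ d {ξ I κ} → NatD n τ (d ++ act neg ξ I ∷ κ ∷ []) →
              ∃[ m ] (m < n × ξ ≡ σ ++ bar (i + m) ++ 0 ∷ [] × I ≡ 1 ∷ [] ×
                      κ ≡ act pos (σ ++ bar (suc (i + m))) (natRam n (suc m)))
  nat-reply zero    i _ []          ()
  nat-reply zero    i _ (_ ∷ d)     e = ⊥-elim (++-∷-≢-[] d (∷-injectiveʳ e))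
  nat-reply (suc n) i _ []          (inj₁ ())
  nat-reply (suc n) i _ (_ ∷ d)     (inj₁ e) = ⊥-elim (++-∷-≢-[] d (∷-injectiveʳ e))
  nat-reply (suc n) i _ []          (inj₂ (inj₁ ()))
  nat-reply (suc n) i _ (_ ∷ [])    (inj₂ (inj₁ ()))
  nat-reply (suc n) i _ (_ ∷ _ ∷ d) (inj₂ (inj₁ e)) = ⊥-elim (++-∷-≢-[] d (∷-injectiveʳ (∷-injectiveʳ e)))
  nat-reply (suc n) i _ []          (inj₂ (inj₂ (_ , _ , ())))
  nat-reply (suc n) i refl (_ ∷ []) {κ = κ} (inj₂ (inj₂ (_ , p , refl))) =
    0 , s≤s z≤n ,
    trans (++-assoc σ (bar i) (0 ∷ [])) (cong (λ m → σ ++ bar m ++ 0 ∷ []) (sym (+-identityʳ i))) , refl ,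
    trans (nat-first n _ κ p)
          (cong (λ τ → act pos τ (natRam n 0))
                (trans (++-assoc σ (bar i) (0 ∷ 1 ∷ [])) (cong (λ m → σ ++ bar (suc m)) (sym (+-identityʳ i)))))
  nat-reply (suc n) i refl (_ ∷ _ ∷ d) {ξ} {κ = κ} (inj₂ (inj₂ (_ , p , refl)))
    with nat-reply n (suc i) (++-assoc σ (bar i) (0 ∷ 1 ∷ [])) d p
  ... | m , m<n , eξ , eI , eκ =
    suc m , s≤s m<n , subst (λ j → ξ ≡ σ ++ bar j ++ 0 ∷ []) (sym (+-suc i m)) eξ , eI ,
    subst (λ j → κ ≡ act pos (σ ++ bar (suc j)) (natRam n (suc m))) (sym (+-suc i m)) eκ

  chain-neg-actions : ∀ k {ζ J} → act neg ζ J ∈ chain k → ∃[ j ] (j < k × ζ ≡ σ ++ bar j × J ≡ 0 ∷ [])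
  chain-neg-actions (suc k) {ζ} {J} m with ∈-++⁻ (chain k) (subst (act neg ζ J ∈_) (chain-suc k) m)
  ... | inj₁ m' with chain-neg-actions k m'
  ...   | j , j<k , e₁ , e₂ = j , m≤n⇒m≤1+n j<k , e₁ , e₂
  chain-neg-actions (suc k) m | inj₂ (here refl)       = k , ≤-refl , refl , refl
  chain-neg-actions (suc k) m | inj₂ (there (here ()))

  -- A negative action after chain (suc j) can only be justified by a⁺ j; an initial one repeats the address σ.
  neg-after-chain : ∀ j k {I v} → IsChronicle (nbase σ) (chain j ++ a⁻ k I ∷ v) → j ≡ k
  neg-after-chain j k {I} {v} ch with IsChronicle.justified ch (chain j) v neg (σ ++ bar k) I refl
  neg-after-chain j k ch | inj₁ (_ , e) with bar-injective k 0 (++-cancelˡ σ _ _ (trans e (sym (++-identityʳ σ))))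
  neg-after-chain zero    .0 ch | inj₁ _ | refl = refl
  neg-after-chain (suc j) .0 {I} {v} ch | inj₁ _ | refl =
    ⊥-elim (IsChronicle.distinct ch [] (a⁺ 0 ∷ links neg 1 j) v neg neg (σ ++ bar 0) (0 ∷ []) I refl)
  neg-after-chain zero    k ch | inj₂ (_ , _ , _ , u' , _ , _ , e) = ⊥-elim (++-∷-≢-[] u' (sym e))
  neg-after-chain (suc j) k ch | inj₂ (_ , _ , _ , u' , e₁ , i∈J , e₂)
    with ∷ʳ-injective (chain j ∷ʳ a⁻ j (0 ∷ [])) u' (trans (sym (chain-suc-∷ʳ j)) e₂)
  ... | _ , refl with i∈J
  ...   | there ()
  ...   | here refl = sym (bar-injective k (suc j) (++-cancelˡ σ _ _ (begin
    σ ++ bar k                              ≡⟨ e₁ ⟩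
    (σ ++ bar j ++ 0 ∷ []) ++ 1 ∷ []         ≡⟨ ++-assoc σ (bar j ++ 0 ∷ []) (1 ∷ []) ⟩
    σ ++ (bar j ++ 0 ∷ []) ++ 1 ∷ []         ≡⟨ cong (σ ++_) (++-assoc (bar j) (0 ∷ []) (1 ∷ [])) ⟩
    σ ++ bar (suc j)                        ∎)))
    where open ≡-Reasoning

  address-injective : ∀ m k {x y} → σ ++ bar m ++ x ∷ [] ≡ (σ ++ bar k) ++ y ∷ [] → m ≡ k
  address-injective m k {y = y} e =
    bar-injective m k (∷ʳ-injectiveˡ (bar m) (bar k) (++-cancelˡ σ _ _ (trans e (++-assoc σ (bar k) (y ∷ [])))))

  -- If the justifier were some a⁻ m {0} inside chain k, the address σ.m̄.0 of a⁺ m would be used twice.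
  pos-after-chain : ∀ k {I m J} →
                    IsChronicle (nbase σ) (chain k ++ a⁻ k I ∷ act pos (σ ++ bar m ++ 0 ∷ []) J ∷ []) → m ≡ k
  pos-after-chain k {I} {m} {J} ch
    with IsChronicle.justified ch (chain k ∷ʳ a⁻ k I) [] pos (σ ++ bar m ++ 0 ∷ []) J (sym (∷ʳ-++ (chain k) _ _))
  ... | inj₁ (() , _)
  ... | inj₂ (ζ , i , J' , e₁ , i∈J' , mem) with ∈-++⁻ (chain k) mem
  ...   | inj₂ (there ())
  ...   | inj₂ (here refl) = address-injective m k e₁
  ...   | inj₁ mem' with chain-neg-actions k mem'
  ...     | j , j<k , refl , refl with i∈J'
  ...       | there ()
  ...       | here refl with address-injective m j e₁
  ...         | refl with chain-extends j<k
  ...           | rest , ext = ⊥-elim (IsChronicle.distinct ch (chain m ∷ʳ a⁻ m (0 ∷ [])) (rest ++ a⁻ k I ∷ []) []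
                                      pos pos (σ ++ bar m ++ 0 ∷ []) (1 ∷ []) J (begin
    chain k ++ a⁻ k I ∷ x ∷ []                                              ≡⟨ ext (a⁻ k I ∷ x ∷ []) ⟩
    chain m ++ a⁻ m (0 ∷ []) ∷ a⁺ m ∷ rest ++ a⁻ k I ∷ x ∷ []               ≡⟨ sym (∷ʳ-++ (chain m) _ _) ⟩
    (chain m ∷ʳ a⁻ m (0 ∷ [])) ++ a⁺ m ∷ rest ++ a⁻ k I ∷ x ∷ []             ≡⟨ cong (λ l → _ ++ a⁺ m ∷ l)
                                                                                   (sym (∷ʳ-++ rest _ (x ∷ []))) ⟩
    (chain m ∷ʳ a⁻ m (0 ∷ [])) ++ a⁺ m ∷ (rest ++ a⁻ k I ∷ []) ++ x ∷ []     ∎))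
    where
    open ≡-Reasoning
    x : Action
    x = act pos (σ ++ bar m ++ 0 ∷ []) J

  links-pos-suc : ∀ k x → links pos 0 (suc k) ++ x ∷ [] ≡
                  (links pos 0 k ∷ʳ act pos (σ ++ bar k) (0 ∷ [])) ++ act neg (σ ++ bar k ++ 0 ∷ []) (1 ∷ []) ∷ x ∷ []
  links-pos-suc k x = trans (cong (_++ x ∷ []) (links-suc pos 0 k))
                            (trans (++-assoc (links pos 0 k) (pair pos k) (x ∷ [])) (sym (∷ʳ-++ (links pos 0 k) _ _)))

  module _ {E : Des} (pc : PrefixClosed E) {n g} (g≤n : g ≤ n)
           (reply : E (daimonAt g (natRam n g))) where

    chain-below-reply : ∀ {k} → k < g → E (chain (suc k))
    chain-below-reply {k} k<g with chain-extends k<g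
    ... | rest , ext = prefixClosed-++ pc (chain (suc k)) (rest ++ _) (λ ())
                         (subst E (trans (ext _) (sym (chain-suc-++ k _))) reply)

    -- n_σ descends the chain from depth k, gap steps above the depth g at which E plays ✠.
    play-down : ∀ gap k I → gap + k ≡ g → I ≡ natRam n k → ∀ {LX LY} → chain k ∈ [] ∷ LY →
                (links pos 0 k ++ act pos (σ ++ bar k) I ∷ []) ∈ LX →
                Conv (NatD n σ) E LX LY (act pos (σ ++ bar k) I)
    play-down zero      k I refl refl mY mX = step mY reply done
    play-down (suc gap) k I gap+k≡g I≡ {LX} {LY} mY mX = descend (trans I≡ (natRam-< k<n))
      where
      k<g : k < g
      k<g = subst (k <_) gap+k≡g (s≤s (m≤n+m k gap))
      k<n : k < n
      k<n = <-≤-trans k<g g≤n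
      descend : I ≡ 0 ∷ [] → Conv (NatD n σ) E LX LY (act pos (σ ++ bar k) I)
      descend refl =
        step mY (subst E (chain-suc k) (chain-below-reply k<g))
          (step (there mX) (subst (NatD n σ) (links-pos-suc k _) (nat-chronicle n (suc k) k<n))
            (play-down gap (suc k) _ (trans (+-suc gap k) gap+k≡g) refl
                       (there (here (chain-suc k))) (here (links-pos-suc k _))))

  answers⇒orth : ∀ {E} n → PrefixClosed E → Answers E n → Orth (NatD n σ) E
  answers⇒orth n pc ans with answers⇒reply n ans
  ... | g , g≤n , reply =
    act pos (σ ++ bar 0) (natRam n 0) , nat-chronicle n 0 z≤n ,
    play-down pc g≤n reply g 0 (natRam n 0) (+-identityʳ g) refl (here refl) (here refl)

  AllChains : List Chron → Set
  AllChains L = ∀ d → d ∈ [] ∷ L → ∃[ j ] (d ≡ chain j)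

  module _ {E : Des} (isE : IsDesign (nbase σ) E) {n : ℕ} where

    mutual
      answers-at-nat-move : ∀ k → k ≤ n → ∀ {LX LY κ} → κ ≡ act pos (σ ++ bar k) (natRam n k) → AllChains LY →
                            Conv (NatD n σ) E LX LY κ → Answers E n
      answers-at-nat-move k k≤n () _ done
      answers-at-nat-move k k≤n refl chains (step {d = d} d∈ Ed conv) with chains d d∈
      ... | j , refl with neg-after-chain j k (IsDesign.chron isE _ Ed)
      ...   | refl = answers-at-design-move k k≤n Ed chains conv

      answers-at-design-move : ∀ k → k ≤ n → ∀ {LX LY κ} → E (chain k ++ a⁻ k (natRam n k) ∷ κ ∷ []) → AllChains LY →
                               Conv E (NatD n σ) ((chain k ++ a⁻ k (natRam n k) ∷ κ ∷ []) ∷ LY) LX κ → Answers E n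
      answers-at-design-move k k≤n Ed _ done = reply⇒answers k≤n Ed
      answers-at-design-move k k≤n {LY = LY} Ed chains (step {d = d} _ Nd conv)
        with nat-reply n 0 (sym (++-identityʳ σ)) d Nd
      ... | m , m<n , refl , refl , eκ with pos-after-chain k {m = m} (IsDesign.chron isE _ Ed)
      ...   | refl = answers-at-nat-move (suc k) m<n eκ chains' conv
        where
        chains' : AllChains ((chain k ++ a⁻ k (natRam n k) ∷ a⁺ k ∷ []) ∷ LY)
        chains' d (here e)         = 0 , e
        chains' d (there (here e)) =
          suc k , trans e (trans (cong (λ I → chain k ++ a⁻ k I ∷ a⁺ k ∷ []) (natRam-< m<n)) (sym (chain-suc k)))
        chains' d (there (there m)) = chains d (there m)

  orth⇒answers : ∀ {E} → IsDesign (nbase σ) E → ∀ n → Orth (NatD n σ) E → Answers E n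
  orth⇒answers isE n (κ , Nκ , conv) =
    answers-at-nat-move isE 0 z≤n
      (trans (nat-first n σ κ Nκ) (cong (λ τ → act pos τ (natRam n 0)) (sym (++-identityʳ σ)))) chains₀ conv
    where
    chains₀ : AllChains []
    chains₀ d (here e) = 0 , e

  forced-by-answers : ∀ {D D'} → IsCoherent D → PrefixClosed D' → (∀ c → D' c → D c) → (∀ n → Answers D' n) →
                      ∀ k t → D (chain k ++ ending k t) → D' (chain k ++ ending k t)
  forced-by-answers {D} {D'} coh pc D'⊆D answers k t p = go t p (answers (suc k))
    where
    excluded : ∀ n {r} → DaimonBefore D' n → ¬ D (chain n ++ r)
    excluded n d = daimonBefore-excludes coh n (daimonBefore-map (λ _ → D'⊆D _) n d)

    t∅✠-∈ : D' (chain k ++ ending k t∅✠)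
    t∅✠-∈ with answers k
    ... | inj₁ q = q
    ... | inj₂ d = ⊥-elim (excluded k d p)

    go : ∀ t → D (chain k ++ ending k t) → Answers D' (suc k) → D' (chain k ++ ending k t)
    go t∅  _ _               = prefixClosed-∷ʳ pc (chain k) _ _ t∅✠-∈
    go t∅✠ _ _               = t∅✠-∈
    go _   p (inj₂ (inj₁ d)) = ⊥-elim (excluded k d p)
    go t0  _ (inj₂ (inj₂ q)) = prefixClosed-∷ʳ pc (chain k) _ _ q
    go t0✠ _ (inj₂ (inj₂ q)) = q
    go t0⁺ p (inj₂ (inj₂ q)) = ⊥-elim (excluded (suc k) (inj₂ q) (subst D (sym (chain-suc-++ k [])) p))
    go t0  _ (inj₁ q)        = prefixClosed-∷ʳ pc (chain k) _ _ (subst D' (chain-suc-++ k _) q)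
    go t0⁺ _ (inj₁ q)        = subst D' (chain-suc k) (prefixClosed-++ pc (chain (suc k)) _ (λ ()) q)
    go t0✠ p (inj₁ q)        = ⊥-elim (daimonBefore-excludes coh (suc k) (inj₂ p) (D'⊆D _ q))

  module _ (D : Des) (isD : IsDesign (nbase σ) D) (sh : ShortOf (FD σ 0) D) where
    private
      s : (c : Chron) → FD σ 0 c → Chron
      s = proj₁ sh

      s-shortens : ∀ c q → IsShortening (s c q) c
      s-shortens = proj₁ (proj₂ sh)

      s-onto : ∀ c → D c → ∃[ c' ] Σ (FD σ 0 c') λ q → s c' q ≡ c
      s-onto c = proj₁ (proj₂ (proj₂ sh) c)

      s-∈ : ∀ c q → D (s c q)
      s-∈ c q = proj₂ (proj₂ (proj₂ sh) (s c q)) (c , q , refl)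

    shortening⇒F✠ : ∀ c → D c → F✠ c
    shortening⇒F✠ c p with s-onto c p
    ... | c' , q , refl with FD-view q
    ...   | k , t , _ , e = shortening-F✠ k t (subst (IsShortening (s c' q)) e (s-shortens c' q))

    shortening-answers : ∀ n → Answers D n
    shortening-answers n
      with shortening-cases n t∅✠ (s-shortens _ (F-chronicle n t∅✠ tt)) | s-∈ _ (F-chronicle n t∅✠ tt)
    ... | inj₁ e                    | s∈D = inj₁ (subst D e s∈D)
    ... | inj₂ (inj₁ (j , j<n , e)) | s∈D = inj₂ (daimonBefore-intro j<n (subst D e s∈D))
    ... | inj₂ (inj₂ e)             | s∈D = inj₁ (subst D e s∈D)

    shortening⇒material : MaterialNatPerp σ D
    shortening⇒material = (isD , λ n → answers⇒orth n (IsDesign.prefixCl isD) (shortening-answers n)) , minimal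
      where
      minimal : ∀ D' → InNatPerp σ D' → (∀ c → D' c → D c) → ∀ c → D c → D' c
      minimal D' (isD' , orth') D'⊆D c p with shortening⇒F✠ c p
      ... | k , t , refl = forced-by-answers (IsDesign.coherent isD) (IsDesign.prefixCl isD') D'⊆D
                                  (λ n → orth⇒answers isD' n (orth' n)) k t p

  cut : ∀ {E} n → DaimonBefore E n → Chron
  cut (suc n) (inj₁ d) = cut n d
  cut (suc n) (inj₂ _) = chain n ++ ending n t0✠

  cut-∈ : ∀ {E} n (d : DaimonBefore E n) → E (cut n d)
  cut-∈ (suc n) (inj₁ d) = cut-∈ n d
  cut-∈ (suc n) (inj₂ p) = p

  cut-shortens : ∀ {E} n (d : DaimonBefore E n) r → IsShortening (cut n d) (chain n ++ r)
  cut-shortens (suc n) (inj₁ d) r = subst (IsShortening (cut n d)) (sym (chain-suc-++ n r)) (cut-shortens n d _)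
  cut-shortens (suc n) (inj₂ _) r =
    inj₂ (chain n ∷ʳ a⁻ n (0 ∷ []) , a⁺ n ∷ r , trans (chain-suc-++ n r) (sym (∷ʳ-++ (chain n) _ _)) ,
          (chain n , _ , _ , refl) , sym (∷ʳ-++ (chain n) _ (daimon ∷ [])))

  cut0 : Tail → Tail
  cut0 t0⁺ = t0✠
  cut0 t   = t

  cut0-shortens : ∀ k t → IsShortening (chain k ++ ending k (cut0 t)) (chain k ++ ending k t)
  cut0-shortens k t∅  = inj₁ refl
  cut0-shortens k t∅✠ = inj₁ refl
  cut0-shortens k t0  = inj₁ refl
  cut0-shortens k t0✠ = inj₁ refl
  cut0-shortens k t0⁺ =
    inj₂ (chain k ∷ʳ a⁻ k (0 ∷ []) , a⁺ k ∷ [] , sym (∷ʳ-++ (chain k) _ _) ,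
          (chain k , _ , _ , refl) , sym (∷ʳ-++ (chain k) _ (daimon ∷ [])))

  origin : Tail → Tail
  origin t0✠ = t0⁺
  origin t   = t

  origin-InF : ∀ t → InF (origin t)
  origin-InF t∅  = tt
  origin-InF t∅✠ = tt
  origin-InF t0  = tt
  origin-InF t0⁺ = tt
  origin-InF t0✠ = tt

  module _ (D : Des) (isD : IsDesign (nbase σ) D) (mat : MaterialNatPerp σ D) where
    private
      coh : IsCoherent D
      coh = IsDesign.coherent isD

      pc : PrefixClosed D
      pc = IsDesign.prefixCl isD

    material-answers : ∀ n → Answers D n
    material-answers n = orth⇒answers isD n (proj₂ (proj₁ mat) n)

    D∩F✠ : Des
    D∩F✠ c = D c × F✠ c

    D∩F✠-maxPos : ∀ c → D∩F✠ c → EndsNeg c → ∃[ a ] D∩F✠ (c ∷ʳ a)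
    D∩F✠-maxPos _ (p , k , t∅✠ , refl) en with EndsNeg-++-∷-∷ (chain k) _ _ en
    ... | ()
    D∩F✠-maxPos _ (p , k , t0⁺ , refl) en with EndsNeg-++-∷-∷ (chain k) _ _ en
    ... | ()
    D∩F✠-maxPos _ (p , k , t0✠ , refl) en with EndsNeg-++-∷-∷ (chain k) _ _ en
    ... | ()
    D∩F✠-maxPos _ (p , k , t∅ , refl) _ with material-answers k
    ... | inj₁ q = daimon , subst D (sym (∷ʳ-++ (chain k) _ _)) q , k , t∅✠ , ∷ʳ-++ (chain k) _ _
    ... | inj₂ d = ⊥-elim (daimonBefore-excludes coh k d p)
    D∩F✠-maxPos _ (p , k , t0 , refl) _ with material-answers (suc k)
    ... | inj₂ (inj₁ d) = ⊥-elim (daimonBefore-excludes coh k d p)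
    ... | inj₂ (inj₂ q) = daimon , subst D (sym (∷ʳ-++ (chain k) _ _)) q , k , t0✠ , ∷ʳ-++ (chain k) _ _
    ... | inj₁ q = a⁺ k , subst D (chain-suc-∷ʳ k) (prefixClosed-++ pc (chain (suc k)) _ (λ ()) q) ,
                   k , t0⁺ , ∷ʳ-++ (chain k) _ _

    D∩F✠-isDesign : IsDesign (nbase σ) D∩F✠
    D∩F✠-isDesign = record
      { chron    = λ c p → IsDesign.chron isD c (proj₁ p)
      ; prefixCl = λ c a c≢[] p → pc c a c≢[] (proj₁ p) , F✠-prefixClosed c a c≢[] (proj₂ p)
      ; coherent = λ c c' p p' → coh c c' (proj₁ p) (proj₁ p')
      ; maxPos   = D∩F✠-maxPos
      }

    D∩F✠-answers : ∀ n → Answers D∩F✠ n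
    D∩F✠-answers n with material-answers n
    ... | inj₁ q = inj₁ (q , n , t∅✠ , refl)
    ... | inj₂ d = inj₂ (daimonBefore-map (λ g q → q , g , t0✠ , refl) n d)

    material⇒F✠ : ∀ c → D c → F✠ c
    material⇒F✠ c p =
      proj₂ (proj₂ mat D∩F✠ (D∩F✠-isDesign , λ n → answers⇒orth n (IsDesign.prefixCl D∩F✠-isDesign) (D∩F✠-answers n))
                      (λ _ → proj₁) c p)

    -- How D answers n_σ for n = k+1 decides how much of a chronicle of F of depth k survives in D.
    shorten : ∀ k → Tail → Answers D (suc k) → Chron
    shorten k t (inj₁ _)        = chain k ++ ending k t
    shorten k t (inj₂ (inj₁ d)) = cut k d
    shorten k t (inj₂ (inj₂ _)) = chain k ++ ending k (cut0 t)

    shorten-shortens : ∀ k t a → IsShortening (shorten k t a) (chain k ++ ending k t)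
    shorten-shortens k t (inj₁ _)        = inj₁ refl
    shorten-shortens k t (inj₂ (inj₁ d)) = cut-shortens k d _
    shorten-shortens k t (inj₂ (inj₂ _)) = cut0-shortens k t

    t∅✠-∈ : ∀ k {r} → D (chain k ++ r) → D (chain k ++ ending k t∅✠)
    t∅✠-∈ k p with material-answers k
    ... | inj₁ q = q
    ... | inj₂ d = ⊥-elim (daimonBefore-excludes coh k d p)

    shorten-∈ : ∀ k t a → InF t → D (shorten k t a)
    shorten-∈ k t   (inj₂ (inj₁ d)) _ = cut-∈ k d
    shorten-∈ k t∅  (inj₁ q)        _ = prefixClosed-∷ʳ pc (chain k) _ _ (t∅✠-∈ k (subst D (chain-suc-++ k _) q))
    shorten-∈ k t∅✠ (inj₁ q)        _ = t∅✠-∈ k (subst D (chain-suc-++ k _) q)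
    shorten-∈ k t0  (inj₁ q)        _ = prefixClosed-∷ʳ pc (chain k) _ _ (subst D (chain-suc-++ k _) q)
    shorten-∈ k t0⁺ (inj₁ q)        _ = subst D (chain-suc k) (prefixClosed-++ pc (chain (suc k)) _ (λ ()) q)
    shorten-∈ k t∅  (inj₂ (inj₂ q)) _ = prefixClosed-∷ʳ pc (chain k) _ _ (t∅✠-∈ k q)
    shorten-∈ k t∅✠ (inj₂ (inj₂ q)) _ = t∅✠-∈ k q
    shorten-∈ k t0  (inj₂ (inj₂ q)) _ = prefixClosed-∷ʳ pc (chain k) _ _ q
    shorten-∈ k t0⁺ (inj₂ (inj₂ q)) _ = q

    shorten-origin : ∀ k t a → D (chain k ++ ending k t) → shorten k (origin t) a ≡ chain k ++ ending k t
    shorten-origin k t   (inj₂ (inj₁ d)) p = ⊥-elim (daimonBefore-excludes coh k d p)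
    shorten-origin k t0✠ (inj₁ q)        p = ⊥-elim (daimonBefore-excludes coh (suc k) (inj₂ p) q)
    shorten-origin k t0⁺ (inj₂ (inj₂ q)) p =
      ⊥-elim (daimonBefore-excludes coh (suc k) (inj₂ q) (subst D (sym (chain-suc-++ k [])) p))
    shorten-origin k t∅  (inj₁ _)        _ = refl
    shorten-origin k t∅✠ (inj₁ _)        _ = refl
    shorten-origin k t0  (inj₁ _)        _ = refl
    shorten-origin k t0⁺ (inj₁ _)        _ = refl
    shorten-origin k t∅  (inj₂ (inj₂ _)) _ = refl
    shorten-origin k t∅✠ (inj₂ (inj₂ _)) _ = refl
    shorten-origin k t0  (inj₂ (inj₂ _)) _ = refl
    shorten-origin k t0✠ (inj₂ (inj₂ _)) _ = refl

    shortenView : ∀ {c} → FView c → Chron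
    shortenView (k , t , _) = shorten k t (material-answers (suc k))

    shortenView-shortens : ∀ {c} (v : FView c) → IsShortening (shortenView v) c
    shortenView-shortens (k , t , _ , refl) = shorten-shortens k t (material-answers (suc k))

    shortenView-∈ : ∀ {c} (v : FView c) → D (shortenView v)
    shortenView-∈ (k , t , t∈F , _) = shorten-∈ k t (material-answers (suc k)) t∈F

    shortenView-unique : ∀ k t (v : FView (chain k ++ ending k t)) →
                         shortenView v ≡ shorten k t (material-answers (suc k))
    shortenView-unique k t (k' , t' , _ , e) with chain-ending-injective e
    ... | refl , refl = refl

    shortenF : (c : Chron) → FD σ 0 c → Chron
    shortenF c q = shortenView (FD-view q)

    shortenF-onto : ∀ c → D c → ∃[ c' ] Σ (FD σ 0 c') λ q → shortenF c' q ≡ c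
    shortenF-onto c p with material⇒F✠ c p
    ... | k , t , refl =
      _ , q , trans (shortenView-unique k (origin t) (FD-view q)) (shorten-origin k t (material-answers (suc k)) p)
      where
      q : FD σ 0 (chain k ++ ending k (origin t))
      q = F-chronicle k (origin t) (origin-InF t)

    material⇒shortening : ShortOf (FD σ 0) D
    material⇒shortening =
      shortenF , (λ c q → shortenView-shortens (FD-view q)) ,
      λ c → shortenF-onto c , λ { (c' , q , refl) → shortenView-∈ (FD-view q) }

mainTheorem10 : (σ : Addr) (D : Des) → IsDesign (nbase σ) D →
                  (MaterialNatPerp σ D ⇔ ShortOf (FD σ 0) D)
mainTheorem10 σ D isD = mk⇔ (material⇒shortening σ D isD) (shortening⇒material σ D isD)
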